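{- Let $n\ge 1$ be an integer and for integers $\ell,m$ with $1\le \ell\le m$ let $c(\ell,m)=\frac{2^{\ell-1}\cdot m!\cdot (m-1)!}{(m-\ell)!}$. Let $C\in\mathbb{Z}^{n\times n}$ be the matrix with entries $C_{ij}=c(i,j+n)$ for $i,j\in\{1,\dots,n\}$. Then $C$ has full rank. -}

module Defs where

open import Data.Nat using (ℕ; suc; _+_; _*_; _∸_; _^_; _!)
open import Data.Nat.DivMod using (_/_)
open import Data.Nat.Properties using (_!≢0)
open import Data.Fin using (Fin; toℕ)
open import Data.Integer using (ℤ; +_)
import Data.Rational as ℚ
open ℚ using (ℚ; 0ℚ)
open import Relation.Binary.PropositionalEquality using (_≡_)

-- c(ℓ,m) = 2^(ℓ-1) · m! · (m-1)! / (m-ℓ)!   (exact division; used with 1 ≤ ℓ ≤ m)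
c : ℕ → ℕ → ℕ
c ℓ m = (2 ^ (ℓ ∸ 1) * m ! * (m ∸ 1) !) / (m ∸ ℓ) !
  where instance _ = (m ∸ ℓ) !≢0

-- The n×n integer matrix C with C_ij = c(i, j+n), i,j ∈ {1..n}
-- (Fin index i represents the integer toℕ i + 1).
Cmat : (n : ℕ) → Fin n → Fin n → ℤ
Cmat n i j = + c (suc (toℕ i)) (suc (toℕ j) + n)

Σℚ : ∀ {n} → (Fin n → ℚ) → ℚ
Σℚ {ℕ.zero} f = 0ℚ
Σℚ {suc n} f = f Fin.zero ℚ.+ Σℚ (λ k → f (Fin.suc k))

FullRank : (n : ℕ) → (Fin n → Fin n → ℤ) → Set
FullRank n M = (x : Fin n → ℚ) →
  (∀ i → Σℚ (λ j → (M i j ℚ./ 1) ℚ.* x j) ≡ 0ℚ) → ∀ j → x j ≡ 0ℚ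

-- Since m!/(m-t)! = m(m-1)⋯(m-t+1), the entry C_ij is 2^(i-1) (j+n)! N_(i-1)(j+n-1),
-- where N_t(x) = x(x-1)⋯(x-t+1) is a Newton polynomial of degree t.  Scaling rows and
-- columns by nonzero factors does not change the rank, so it suffices that the matrix
-- (N_t(x_j)) is nonsingular for distinct nodes x_j.  As for Vandermonde matrices, this
-- follows by induction on n: multiplying a kernel vector by (x_j - x_0) kills its first
-- coordinate and, since x N_t(x) is a combination of N_(t+1) and N_t, keeps it in the
-- kernel of the matrix for the remaining nodes.
module Submission where

open import Defs
open import Data.Nat as ℕ using (ℕ; zero; suc; _≤_; _<_; _!; _^_; _∸_)
import Data.Nat.Properties as ℕ
import Data.Nat.DivMod as ℕ using (_/_; *-/-assoc)
open import Data.Nat.Divisibility using (m≤n⇒m!∣n!)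
open import Data.Nat.Combinatorics.Base using (_P′_)
open import Data.Nat.Combinatorics.Specification using (nP′k≡n!/[n∸k]!)
import Data.Nat.Coprimality as Coprimality
import Data.Integer as ℤ
import Data.Integer.Properties as ℤ
open import Data.Rational using (ℚ; mkℚ; ↥_; 0ℚ; 1ℚ; 1/_; _+_; _*_; _-_; _/_; ≢-nonZero)
open import Data.Rational.Properties
  using (normalize-coprime; /-cong; +-*-commutativeRing; +-0-group; +-inverseʳ; +-identityˡ;
         +-identityʳ; *-inverseˡ; *-assoc; *-zeroˡ; *-zeroʳ; *-identityˡ)
open import Data.Rational.Solver using (module +-*-Solver)
open +-*-Solver using (solve; _:=_; _:+_; _:*_; _:-_)
open import Algebra.Bundles using (CommutativeRing)
open import Algebra.Properties.Group +-0-group using (x∙y⁻¹≈ε⇒x≈y)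
open import Algebra.Properties.Semiring.Sum (CommutativeRing.semiring +-*-commutativeRing)
  using (sum; sum-cong-≗; ∑-distrib-+; *-distribˡ-sum; sum-replicate-zero)
open import Data.Fin as Fin using (Fin; toℕ; fromℕ<)
import Data.Fin.Properties as Fin
open import Function using (_∘_; Injective)
open import Relation.Binary.PropositionalEquality

p≢0∧p*q≡0⇒q≡0 : ∀ p q → p ≢ 0ℚ → p * q ≡ 0ℚ → q ≡ 0ℚ
p≢0∧p*q≡0⇒q≡0 p q p≢0 pq≡0 = begin
  q              ≡⟨ *-identityˡ q ⟨
  1ℚ * q         ≡⟨ cong (_* q) (*-inverseˡ p) ⟨
  1/ p * p * q   ≡⟨ *-assoc (1/ p) p q ⟩
  1/ p * (p * q) ≡⟨ cong (1/ p *_) pq≡0 ⟩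
  1/ p * 0ℚ      ≡⟨ *-zeroʳ (1/ p) ⟩
  0ℚ             ∎
  where
  open ≡-Reasoning
  instance _ = ≢-nonZero p≢0

Σℚ≡sum : ∀ {n} (f : Fin n → ℚ) → Σℚ f ≡ sum f
Σℚ≡sum {zero}  f = refl
Σℚ≡sum {suc n} f = cong (f Fin.zero +_) (Σℚ≡sum (f ∘ Fin.suc))

fromℕ : ℕ → ℚ
fromℕ n = ℤ.+ n / 1

fromℕ≡mkℚ : ∀ n → fromℕ n ≡ mkℚ (ℤ.+ n) 0 (Coprimality.sym (Coprimality.1-coprimeTo n))
fromℕ≡mkℚ n = normalize-coprime (Coprimality.sym (Coprimality.1-coprimeTo n))

fromℕ-homo-+ : ∀ m n → fromℕ (m ℕ.+ n) ≡ fromℕ m + fromℕ n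
fromℕ-homo-+ m n rewrite fromℕ≡mkℚ m | fromℕ≡mkℚ n =
  /-cong (trans (ℤ.pos-+ m n) (sym (cong₂ ℤ._+_ (ℤ.*-identityʳ (ℤ.+ m)) (ℤ.*-identityʳ (ℤ.+ n)))))
         refl

fromℕ-homo-* : ∀ m n → fromℕ (m ℕ.* n) ≡ fromℕ m * fromℕ n
fromℕ-homo-* m n rewrite fromℕ≡mkℚ m | fromℕ≡mkℚ n = /-cong (ℤ.pos-* m n) refl

fromℕ-injective : Injective _≡_ _≡_ fromℕ
fromℕ-injective {m} {n} eq rewrite fromℕ≡mkℚ m | fromℕ≡mkℚ n = ℤ.+-injective (cong ↥_ eq)

fromℕ-≢0 : ∀ n → .{{ℕ.NonZero n}} → fromℕ n ≢ 0ℚ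
fromℕ-≢0 n eq = ℕ.≢-nonZero⁻¹ n (fromℕ-injective eq)

fromℕ-∸ : ∀ {m n} → n ≤ m → fromℕ (m ∸ n) ≡ fromℕ m - fromℕ n
fromℕ-∸ {m} {n} n≤m = begin
  fromℕ (m ∸ n)                       ≡⟨ solve 2 (λ x y → x := x :+ y :- y) refl (fromℕ (m ∸ n)) (fromℕ n) ⟩
  fromℕ (m ∸ n) + fromℕ n - fromℕ n   ≡⟨ cong (_- fromℕ n) (fromℕ-homo-+ (m ∸ n) n) ⟨
  fromℕ (m ∸ n ℕ.+ n) - fromℕ n       ≡⟨ cong (λ k → fromℕ k - fromℕ n) (ℕ.m∸n+n≡m n≤m) ⟩
  fromℕ m - fromℕ n                   ∎
  where open ≡-Reasoning

newton : (ℕ → ℚ) → ℕ → ℚ → ℚ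
newton a zero    x = 1ℚ
newton a (suc k) x = newton a k x * (x - a k)

moment : ∀ {n} → (ℕ → ℚ) → ℕ → (Fin n → ℚ) → (Fin n → ℚ) → ℚ
moment a k g y = sum (λ j → newton a k (g j) * y j)

moment-shift : ∀ {n} a k p (g y : Fin n → ℚ) →
               moment a k g (λ j → (g j - p) * y j)
                 ≡ moment a (suc k) g y + (a k - p) * moment a k g y
moment-shift {n} a k p g y = begin
  sum (λ j → N j * ((g j - p) * y j))       ≡⟨ sum-cong-≗ (λ j → split (N j) (g j) (y j)) ⟩
  sum (λ j → N′ j * y j + q * (N j * y j))  ≡⟨ ∑-distrib-+ (λ j → N′ j * y j) (λ j → q * (N j * y j)) ⟩
  sum (λ j → N′ j * y j)
    + sum (λ j → q * (N j * y j))           ≡⟨ cong (sum (λ j → N′ j * y j) +_) (*-distribˡ-sum q (λ j → N j * y j)) ⟨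
  sum (λ j → N′ j * y j)
    + q * sum (λ j → N j * y j)             ∎
  where
  open ≡-Reasoning
  q = a k - p
  N N′ : Fin n → ℚ
  N  j = newton a k (g j)
  N′ j = newton a (suc k) (g j)
  split : ∀ u x v → u * ((x - p) * v) ≡ u * (x - a k) * v + q * (u * v)
  split u x v = solve 5 (λ u x v p b → u :* ((x :- p) :* v) := u :* (x :- b) :* v :+ (b :- p) :* (u :* v))
                        refl u x v p (a k)

moments≡0⇒≡0 : ∀ {n} a (g : Fin n → ℚ) → Injective _≡_ _≡_ g → ∀ y →
               (∀ k → k < n → moment a k g y ≡ 0ℚ) → ∀ j → y j ≡ 0ℚ
moments≡0⇒≡0 {suc n} a g g-injective y moments≡0 = y≡0
  where
  p : ℚ
  p = g Fin.zero

  z : Fin n → ℚ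
  z j = (g (Fin.suc j) - p) * y (Fin.suc j)

  z-moment : ∀ k → moment a k (g ∘ Fin.suc) z ≡ moment a k g (λ j → (g j - p) * y j)
  z-moment k = begin
    moment a k (g ∘ Fin.suc) z              ≡⟨ +-identityˡ _ ⟨
    0ℚ + moment a k (g ∘ Fin.suc) z         ≡⟨ cong (_+ moment a k (g ∘ Fin.suc) z) head≡0 ⟨
    newton a k p * ((p - p) * y Fin.zero)
      + moment a k (g ∘ Fin.suc) z          ∎
    where
    open ≡-Reasoning
    head≡0 : newton a k p * ((p - p) * y Fin.zero) ≡ 0ℚ
    head≡0 rewrite +-inverseʳ p | *-zeroˡ (y Fin.zero) = *-zeroʳ (newton a k p)

  z-moments≡0 : ∀ k → k < n → moment a k (g ∘ Fin.suc) z ≡ 0ℚ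
  z-moments≡0 k k<n = begin
    moment a k (g ∘ Fin.suc) z                         ≡⟨ z-moment k ⟩
    moment a k g (λ j → (g j - p) * y j)               ≡⟨ moment-shift a k p g y ⟩
    moment a (suc k) g y + (a k - p) * moment a k g y  ≡⟨ cong₂ (λ u v → u + (a k - p) * v)
                                                                (moments≡0 (suc k) (ℕ.s≤s k<n))
                                                                (moments≡0 k (ℕ.m<n⇒m<1+n k<n)) ⟩
    0ℚ + (a k - p) * 0ℚ                                ≡⟨ cong (0ℚ +_) (*-zeroʳ (a k - p)) ⟩
    0ℚ                                                 ∎
    where open ≡-Reasoning

  tail≡0 : ∀ j → y (Fin.suc j) ≡ 0ℚ
  tail≡0 j = p≢0∧p*q≡0⇒q≡0 _ _ nodes-differ
               (moments≡0⇒≡0 a (g ∘ Fin.suc) (Fin.suc-injective ∘ g-injective) z z-moments≡0 j)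
    where
    nodes-differ : g (Fin.suc j) - p ≢ 0ℚ
    nodes-differ eq = Fin.0≢1+n (g-injective (sym (x∙y⁻¹≈ε⇒x≈y _ _ eq)))

  y≡0 : ∀ j → y j ≡ 0ℚ
  y≡0 (Fin.suc j) = tail≡0 j
  y≡0 Fin.zero    = begin
    y Fin.zero            ≡⟨ *-identityˡ (y Fin.zero) ⟨
    1ℚ * y Fin.zero       ≡⟨ +-identityʳ (1ℚ * y Fin.zero) ⟨
    1ℚ * y Fin.zero + 0ℚ  ≡⟨ cong (1ℚ * y Fin.zero +_) tail-moment≡0 ⟨
    moment a 0 g y        ≡⟨ moments≡0 0 (ℕ.s≤s ℕ.z≤n) ⟩
    0ℚ                    ∎
    where
    open ≡-Reasoning
    tail-moment≡0 : moment a 0 (g ∘ Fin.suc) (y ∘ Fin.suc) ≡ 0ℚ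
    tail-moment≡0 = trans (sum-cong-≗ (λ j → cong (1ℚ *_) (tail≡0 j))) (sum-replicate-zero n)

c-suc : ∀ {t m} → t ≤ m → c (suc t) (suc m) ≡ 2 ^ t ℕ.* suc m ! ℕ.* (m P′ t)
c-suc {t} {m} t≤m = begin
  2 ^ t ℕ.* suc m ! ℕ.* m ! ℕ./ (m ∸ t) !   ≡⟨ ℕ.*-/-assoc (2 ^ t ℕ.* suc m !) (m≤n⇒m!∣n! (ℕ.m∸n≤m m t)) ⟩
  2 ^ t ℕ.* suc m ! ℕ.* (m ! ℕ./ (m ∸ t) !) ≡⟨ cong (2 ^ t ℕ.* suc m ! ℕ.*_) (nP′k≡n!/[n∸k]! t≤m) ⟨
  2 ^ t ℕ.* suc m ! ℕ.* (m P′ t)            ∎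
  where
  open ≡-Reasoning
  instance _ = (m ∸ t) ℕ.!≢0

fromℕ-P′ : ∀ {m t} → t ≤ m → fromℕ (m P′ t) ≡ newton fromℕ t (fromℕ m)
fromℕ-P′ {m} {zero}  _   = refl
fromℕ-P′ {m} {suc t} t<m = begin
  fromℕ ((m ∸ t) ℕ.* (m P′ t))          ≡⟨ cong fromℕ (ℕ.*-comm (m ∸ t) (m P′ t)) ⟩
  fromℕ ((m P′ t) ℕ.* (m ∸ t))          ≡⟨ fromℕ-homo-* (m P′ t) (m ∸ t) ⟩
  fromℕ (m P′ t) * fromℕ (m ∸ t)        ≡⟨ cong₂ _*_ (fromℕ-P′ (ℕ.<⇒≤ t<m)) (fromℕ-∸ (ℕ.<⇒≤ t<m)) ⟩
  newton fromℕ t (fromℕ m) * (fromℕ m - fromℕ t) ∎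
  where open ≡-Reasoning

fromℕ-c : ∀ {t m} → t ≤ m →
          fromℕ (c (suc t) (suc m)) ≡ fromℕ (2 ^ t) * fromℕ (suc m !) * newton fromℕ t (fromℕ m)
fromℕ-c {t} {m} t≤m = begin
  fromℕ (c (suc t) (suc m))                   ≡⟨ cong fromℕ (c-suc t≤m) ⟩
  fromℕ (2 ^ t ℕ.* suc m ! ℕ.* (m P′ t))      ≡⟨ fromℕ-homo-* (2 ^ t ℕ.* suc m !) (m P′ t) ⟩
  fromℕ (2 ^ t ℕ.* suc m !) * fromℕ (m P′ t)  ≡⟨ cong₂ _*_ (fromℕ-homo-* (2 ^ t) (suc m !)) (fromℕ-P′ t≤m) ⟩
  fromℕ (2 ^ t) * fromℕ (suc m !) * newton fromℕ t (fromℕ m) ∎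
  where open ≡-Reasoning

Cmat-row : ∀ n (x : Fin n → ℚ) i →
           Σℚ (λ j → (Cmat n i j / 1) * x j)
             ≡ fromℕ (2 ^ toℕ i)
                 * moment fromℕ (toℕ i) (λ j → fromℕ (toℕ j ℕ.+ n)) (λ j → fromℕ (suc (toℕ j ℕ.+ n) !) * x j)
Cmat-row n x i = begin
  Σℚ (λ j → (Cmat n i j / 1) * x j)       ≡⟨ Σℚ≡sum (λ j → (Cmat n i j / 1) * x j) ⟩
  sum (λ j → (Cmat n i j / 1) * x j)      ≡⟨ sum-cong-≗ entry ⟩
  sum (λ j → r * (N j * (s j * x j)))     ≡⟨ *-distribˡ-sum r (λ j → N j * (s j * x j)) ⟨
  r * sum (λ j → N j * (s j * x j))       ∎
  where
  open ≡-Reasoning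
  t = toℕ i
  r = fromℕ (2 ^ t)
  s N : Fin n → ℚ
  s j = fromℕ (suc (toℕ j ℕ.+ n) !)
  N j = newton fromℕ t (fromℕ (toℕ j ℕ.+ n))
  entry : ∀ j → (Cmat n i j / 1) * x j ≡ r * (N j * (s j * x j))
  entry j = begin
    fromℕ (c (suc t) (suc (toℕ j ℕ.+ n))) * x j ≡⟨ cong (_* x j) (fromℕ-c t≤m) ⟩
    r * s j * N j * x j                        ≡⟨ solve 4 (λ a b c d → a :* b :* c :* d := a :* (c :* (b :* d)))
                                                          refl r (s j) (N j) (x j) ⟩
    r * (N j * (s j * x j))                    ∎
    where t≤m = ℕ.≤-trans (ℕ.<⇒≤ (Fin.toℕ<n i)) (ℕ.m≤n+m n (toℕ j))

lemma3 : (n : ℕ) → 1 ≤ n → FullRank n (Cmat n)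
lemma3 n _ x Cx≡0 j = p≢0∧p*q≡0⇒q≡0 _ _ (fromℕ-≢0 (suc (m j) !) {{suc (m j) ℕ.!≢0}})
                        (moments≡0⇒≡0 fromℕ g g-injective y moments≡0 j)
  where
  m : Fin n → ℕ
  m j = toℕ j ℕ.+ n

  g y : Fin n → ℚ
  g j = fromℕ (m j)
  y j = fromℕ (suc (m j) !) * x j

  g-injective : Injective _≡_ _≡_ g
  g-injective = Fin.toℕ-injective ∘ ℕ.+-cancelʳ-≡ n _ _ ∘ fromℕ-injective

  row-moment≡0 : ∀ i → moment fromℕ (toℕ i) g y ≡ 0ℚ
  row-moment≡0 i = p≢0∧p*q≡0⇒q≡0 _ _ (fromℕ-≢0 (2 ^ toℕ i) {{ℕ.m^n≢0 2 (toℕ i)}})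
                     (trans (sym (Cmat-row n x i)) (Cx≡0 i))

  moments≡0 : ∀ k → k < n → moment fromℕ k g y ≡ 0ℚ
  moments≡0 k k<n = subst (λ t → moment fromℕ t g y ≡ 0ℚ) (Fin.toℕ-fromℕ< k<n) (row-moment≡0 (fromℕ< k<n))
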